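{- Multiplying two $n\times n$ matrices over a semiring in the MPC model with $n$ processors, each with $O(n)$ words of memory, requires $\Theta(\sqrt{n})$ communication rounds; that is, it can be done in $O(\sqrt{n})$ rounds and every algorithm needs $\Omega(\sqrt{n})$ rounds.
   Context: MPC model: there are $P$ processors, each with $M$ words of local memory; the input is distributed evenly among the processors and the output must be distributed evenly at the end; computation proceeds in synchronous rounds of local computation followed by message exchange, each processor sending and receiving $O(M)$ words per round. Over a general semiring, each product (term) $a_{ix}b_{xj}$ contributing to $c_{ij}=\sum_x a_{ix}b_{xj}$ must be computed explicitly by a processor holding both factors, and terms contributing to different entries of $C$ cannot be combined. -}

module Defs where

open import Data.Nat using (ℕ; zero; suc; _+_; _*_; _≤_)
open import Data.Fin using (Fin)
open import Data.Fin.Subset using (Subset; ⁅_⁆; _∪_; _∩_; Empty; ⊤)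
open import Data.List using (List; length; map)
open import Data.Nat.ListAction using (sum)
open import Relation.Binary.PropositionalEquality using (_≡_)
open import Data.List.Membership.Propositional using (_∈_)
open import Data.Product using (∃; _×_; _,_)
open import Data.Sum using (_⊎_)
open import Data.List.Base using (allFin)

-- Words that can be held in a processor's memory, for n×n matrix
-- multiplication C = A B over a general semiring.
--   entA i x   : the input entry a_{ix}
--   entB x j   : the input entry b_{xj}
--   part i j S : a partial sum  Σ_{x ∈ S} a_{ix} b_{xj}  (S nonempty);
--                a single term a_{ix} b_{xj} is  part i j ⁅ x ⁆,
--                and the output entry c_{ij} is  part i j ⊤.
data Word (n : ℕ) : Set where
  entA : Fin n → Fin n → Word n
  entB : Fin n → Fin n → Word n
  part : Fin n → Fin n → Subset n → Word n

data IsInput {n : ℕ} : Word n → Set where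
  inA : ∀ i x → IsInput (entA i x)
  inB : ∀ x j → IsInput (entB x j)

-- Local computation over a general semiring: what a processor can produce
-- from the words it holds.
data Derivable {n : ℕ} (held : List (Word n)) : Word n → Set where
  hold : ∀ {w} → w ∈ held → Derivable held w
  mul  : ∀ {i x j} → entA i x ∈ held → entB x j ∈ held →
         Derivable held (part i j ⁅ x ⁆)
  add  : ∀ {i j S T} → Derivable held (part i j S) → Derivable held (part i j T) →
         Empty (S ∩ T) → Derivable held (part i j (S ∪ T))

Config : ℕ → Set
Config n = Fin n → List (Word n)

-- Even initial distribution of the 2n² input entries over n processors:
-- only input words, exactly 2n words per processor, every entry present
-- (hence each entry held exactly once).
InitialDist : (n : ℕ) → Config n → Set
InitialDist n s =
  (∀ p {w} → w ∈ s p → IsInput w) ×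
  (∀ p → length (s p) ≡ (2 * n)) ×
  (∀ {w} → IsInput w → ∃ λ p → w ∈ s p)

record Round {n : ℕ} (M : ℕ) (s s' : Config n) : Set where
  field
    L      : Config n
    msg    : Fin n → Fin n → List (Word n)
    local  : ∀ p {w} → w ∈ L p → Derivable (s p) w
    locMem : ∀ p → length (L p) ≤ M
    sendOk : ∀ q p {w} → w ∈ msg q p → w ∈ L q
    sent   : ∀ q → sum (map (λ p → length (msg q p)) (allFin n)) ≤ M
    recv   : ∀ p → sum (map (λ q → length (msg q p)) (allFin n)) ≤ M
    newOk  : ∀ p {w} → w ∈ s' p → w ∈ L p ⊎ (∃ λ q → w ∈ msg q p)
    newMem : ∀ p → length (s' p) ≤ M

Output : {n : ℕ} → Config n → Set
Output {n} s = ∀ (i j : Fin n) → ∃ λ p → part i j ⊤ ∈ s p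

data Run {n : ℕ} (M : ℕ) : Config n → ℕ → Set where
  done : ∀ {s} → Output s → Run M s zero
  step : ∀ {s s' R} → Round M s s' → Run M s' R → Run M s (suc R)

-- Upper bound: Cannon's algorithm on an m × m grid of processors, m = ⌊√n⌋.  The indices are
-- split into m residue classes mod m of about √n indices each; processor (I, K) owns the c_ij
-- with i in class I and j in class I + K, and in stage t it receives the a_ix and b_xj with x in
-- class K + t and adds their products to its partial sums.  The skew makes every input entry
-- needed by a single processor per stage, so all messages and memories stay within O(n) words,
-- and after m + 1 rounds every c_ij is complete.
--
-- Lower bound: over a semiring a term a_ix b_xj enters a partial sum of c_ij only on a processor
-- holding both factors.  A processor with B = O(n) words of memory sees at most B pairs of each
-- kind (i, x), (x, j), (i, j), so by a discrete Loomis–Whitney inequality it creates at most B^{3/2}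
-- new terms per round.  All n³ terms must be created, so R · n · B^{3/2} ≥ n³, i.e. R = Ω(√n).

module Submission where

open import Defs
open import Data.Nat using (ℕ; _*_; _≤_)
open import Data.Product using (∃; ∃₂; _×_; _,_)

module FiniteSums where

  open import Data.Nat using (ℕ; zero; suc; _+_; _*_; _≤_; _<_; z≤n; s≤s; _≟_)
  open import Data.Nat.Properties
  open import Data.Fin using (Fin; zero; suc; toℕ; fromℕ<)
  import Data.Fin.Properties as FinP
  open FinP using (toℕ-fromℕ<)
  open import Function using (_∘_)
  open import Data.List using (List; []; _∷_; length)
  open import Data.List.Relation.Unary.Any as Any using (any?)
  open import Data.Product using (_×_; _,_; proj₁; proj₂)
  open import Data.Sum using (_⊎_; [_,_]′)
  open import Relation.Nullary using (Dec; yes; no; ¬_; contradiction)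
  open import Relation.Nullary.Decidable using (_×-dec_)
  open import Relation.Binary.PropositionalEquality using (_≡_; refl; sym; trans; cong)
  open import Algebra.Properties.Semiring.Sum +-*-semiring public
    using (sum; sum-syntax; sum-cong-≗; ∑-comm; ∑-distrib-+; *-distribˡ-sum; *-distribʳ-sum)

  sum-mono-≤ : ∀ {n} {f g : Fin n → ℕ} → (∀ i → f i ≤ g i) → sum f ≤ sum g
  sum-mono-≤ {zero}  f≤g = z≤n
  sum-mono-≤ {suc n} f≤g = +-mono-≤ (f≤g zero) (sum-mono-≤ (f≤g ∘ suc))

  sum-const : ∀ n a → ∑[ i < n ] a ≡ n * a
  sum-const zero    a = refl
  sum-const (suc n) a = cong (a +_) (sum-const n a)

  sum-zero : ∀ {n} {f : Fin n → ℕ} → (∀ i → f i ≡ 0) → sum f ≡ 0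
  sum-zero {n} {f} f≡0 = trans (sum-cong-≗ f≡0) (trans (sum-const n 0) (*-zeroʳ n))

  ≤-sum : ∀ {n} (f : Fin n → ℕ) i → f i ≤ sum f
  ≤-sum f zero    = m≤m+n (f zero) _
  ≤-sum f (suc i) = ≤-trans (≤-sum (λ j → f (suc j)) i) (m≤n+m _ (f zero))

  ∑₂ : ∀ {a b} → (Fin a → Fin b → ℕ) → ℕ
  ∑₂ {a} {b} f = ∑[ i < a ] ∑[ j < b ] f i j

  ∑₂-* : ∀ {a b} (f : Fin a → ℕ) (g : Fin b → ℕ) → ∑₂ (λ i j → f i * g j) ≡ sum f * sum g
  ∑₂-* f g = trans (sum-cong-≗ (λ i → sym (*-distribˡ-sum (f i) g))) (sym (*-distribʳ-sum (sum g) f))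

  𝟙 : {P : Set} → Dec P → ℕ
  𝟙 (yes _) = 1
  𝟙 (no _)  = 0

  𝟙≤1 : {P : Set} (d : Dec P) → 𝟙 d ≤ 1
  𝟙≤1 (yes _) = s≤s z≤n
  𝟙≤1 (no _)  = z≤n

  𝟙-yes : {P : Set} (d : Dec P) → P → 𝟙 d ≡ 1
  𝟙-yes (yes _) _ = refl
  𝟙-yes (no ¬p) p = contradiction p ¬p

  𝟙-no : {P : Set} (d : Dec P) → ¬ P → 𝟙 d ≡ 0
  𝟙-no (yes p) ¬p = contradiction p ¬p
  𝟙-no (no _)  _  = refl

  𝟙-≤ : ∀ {P : Set} {m} (d : Dec P) → (P → 1 ≤ m) → 𝟙 d ≤ m
  𝟙-≤ (yes p) 1≤m = 1≤m p
  𝟙-≤ (no _)  1≤m = z≤n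

  𝟙-mono : {P Q : Set} (d : Dec P) (e : Dec Q) → (P → Q) → 𝟙 d ≤ 𝟙 e
  𝟙-mono d e P⇒Q = 𝟙-≤ d (λ p → ≤-reflexive (sym (𝟙-yes e (P⇒Q p))))

  𝟙-⊎ : {P Q R : Set} (d : Dec P) (e : Dec Q) (f : Dec R) → (P → Q ⊎ R) → 𝟙 d ≤ 𝟙 e + 𝟙 f
  𝟙-⊎ d (yes _) f P⇒Q⊎R = 𝟙-≤ d (λ _ → s≤s z≤n)
  𝟙-⊎ d (no ¬q) f P⇒Q⊎R = 𝟙-mono d f λ p → [ (λ q → contradiction q ¬q) , (λ r → r) ]′ (P⇒Q⊎R p)

  𝟙-× : {P Q : Set} (d : Dec P) (e : Dec Q) → 𝟙 (d ×-dec e) ≡ 𝟙 d * 𝟙 e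
  𝟙-× (yes _) (yes _) = refl
  𝟙-× (yes _) (no _)  = refl
  𝟙-× (no _)  _       = refl

  sum-𝟙≤1 : ∀ {n} {P : Fin n → Set} (P? : ∀ i → Dec (P i)) →
            (∀ {i j} → P i → P j → i ≡ j) → ∑[ i < n ] 𝟙 (P? i) ≤ 1
  sum-𝟙≤1 {zero}  P? unique = z≤n
  sum-𝟙≤1 {suc n} P? unique with P? zero
  ... | yes p₀ = ≤-reflexive (cong suc (sum-zero (λ i → 𝟙-no (P? (suc i)) (λ pᵢ → 0≢1+n (cong toℕ (unique p₀ pᵢ))))))
  ... | no _   = sum-𝟙≤1 (P? ∘ suc) (λ pᵢ pⱼ → FinP.suc-injective (unique pᵢ pⱼ))

  ∑₂-𝟙≤1 : ∀ {a b} {P : Fin a → Fin b → Set} (P? : ∀ i j → Dec (P i j)) →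
            (∀ {i j i′ j′} → P i j → P i′ j′ → i ≡ i′ × j ≡ j′) → ∑₂ (λ i j → 𝟙 (P? i j)) ≤ 1
  ∑₂-𝟙≤1 {a} {b} P? unique = begin
      ∑[ i < a ] ∑[ j < b ] 𝟙 (P? i j)
    ≤⟨ sum-mono-≤ row≤𝟙 ⟩
      ∑[ i < a ] 𝟙 (FinP.any? (P? i))
    ≤⟨ sum-𝟙≤1 (λ i → FinP.any? (P? i)) (λ (j , p) (j′ , p′) → proj₁ (unique p p′)) ⟩
      1
    ∎
    where
    open ≤-Reasoning
    row≤𝟙 : ∀ i → ∑[ j < b ] 𝟙 (P? i j) ≤ 𝟙 (FinP.any? (P? i))
    row≤𝟙 i with FinP.any? (P? i)
    ... | yes _  = sum-𝟙≤1 (P? i) (λ p p′ → proj₂ (unique p p′))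
    ... | no ¬∃j = ≤-reflexive (sum-zero (λ j → 𝟙-no (P? i j) (λ p → ¬∃j (j , p))))

  -- Split the count according to the value of the code; each value is taken at most once.
  sum-𝟙≤-injection : ∀ {n} {P : Fin n → Set} (P? : ∀ i → Dec (P i)) k (code : Fin n → ℕ) →
                     (∀ i → P i → code i < k) → (∀ {i j} → P i → P j → code i ≡ code j → i ≡ j) →
                     ∑[ i < n ] 𝟙 (P? i) ≤ k
  sum-𝟙≤-injection {n} {P} P? k code code<k injective = begin
      ∑[ i < n ] 𝟙 (P? i)
    ≤⟨ sum-mono-≤ 𝟙≤hit ⟩
      ∑[ i < n ] ∑[ y < k ] 𝟙 (hits i y)
    ≡⟨ ∑-comm (λ i y → 𝟙 (hits i y)) ⟩
      ∑[ y < k ] ∑[ i < n ] 𝟙 (hits i y)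
    ≤⟨ sum-mono-≤ (λ y → sum-𝟙≤1 (λ i → hits i y)
                     (λ (pᵢ , eᵢ) (pⱼ , eⱼ) → injective pᵢ pⱼ (trans eᵢ (sym eⱼ)))) ⟩
      ∑[ y < k ] 1
    ≡⟨ trans (sum-const k 1) (*-identityʳ k) ⟩
      k
    ∎
    where
    open ≤-Reasoning
    hits : ∀ i (y : Fin k) → Dec (P i × code i ≡ toℕ y)
    hits i y = P? i ×-dec (code i ≟ toℕ y)
    𝟙≤hit : ∀ i → 𝟙 (P? i) ≤ ∑[ y < k ] 𝟙 (hits i y)
    𝟙≤hit i = 𝟙-≤ (P? i) λ p →
      let y = fromℕ< (code<k i p) in
      ≤-trans (≤-reflexive (sym (𝟙-yes (hits i y) (p , sym (toℕ-fromℕ< (code<k i p))))))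
              (≤-sum (λ y → 𝟙 (hits i y)) y)

  ∑₂-𝟙-any≤length : ∀ {A : Set} {a b} {P : Fin a → Fin b → A → Set} (P? : ∀ i j w → Dec (P i j w)) →
                    (∀ w → ∑₂ (λ i j → 𝟙 (P? i j w)) ≤ 1) →
                    ∀ ws → ∑₂ (λ i j → 𝟙 (any? (P? i j) ws)) ≤ length ws
  ∑₂-𝟙-any≤length {a = a} {b} P? unique [] =
    ≤-reflexive (sum-zero {a} (λ i → sum-zero {b} (λ j → refl)))
  ∑₂-𝟙-any≤length {a = a} {b} P? unique (w ∷ ws) = begin
      ∑₂ (λ i j → 𝟙 (any? (P? i j) (w ∷ ws)))
    ≤⟨ sum-mono-≤ (λ i → sum-mono-≤ (λ j → 𝟙-⊎ (any? (P? i j) (w ∷ ws)) (P? i j w) (any? (P? i j) ws) Any.toSum)) ⟩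
      ∑₂ (λ i j → 𝟙 (P? i j w) + 𝟙 (any? (P? i j) ws))
    ≡⟨ trans (sum-cong-≗ (λ i → ∑-distrib-+ (λ j → 𝟙 (P? i j w)) _)) (∑-distrib-+ {a} _ _) ⟩
      ∑₂ (λ i j → 𝟙 (P? i j w)) + ∑₂ (λ i j → 𝟙 (any? (P? i j) ws))
    ≤⟨ +-mono-≤ (unique w) (∑₂-𝟙-any≤length P? unique ws) ⟩
      suc (length ws)
    ∎
    where open ≤-Reasoning

  ∑₂-𝟙≤* : ∀ {a b} {P : Fin a → Fin b → Set} {Q : Fin a → Set} {R : Fin b → Set}
           (P? : ∀ i j → Dec (P i j)) (Q? : ∀ i → Dec (Q i)) (R? : ∀ j → Dec (R j)) →
           (∀ {i j} → P i j → Q i × R j) → ∑₂ (λ i j → 𝟙 (P? i j)) ≤ sum (𝟙 ∘ Q?) * sum (𝟙 ∘ R?)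
  ∑₂-𝟙≤* P? Q? R? P⇒Q×R = ≤-trans
    (sum-mono-≤ λ i → sum-mono-≤ λ j → ≤-trans (𝟙-mono (P? i j) (Q? i ×-dec R? j) P⇒Q×R) (≤-reflexive (𝟙-× (Q? i) (R? j))))
    (≤-reflexive (∑₂-* (𝟙 ∘ Q?) (𝟙 ∘ R?)))

  ∑-𝟙*≤ : ∀ {n} {P : Fin n → Set} (P? : ∀ i → Dec (P i)) → (∀ {i j} → P i → P j → i ≡ j) →
          ∀ a → ∑[ i < n ] (𝟙 (P? i) * a) ≤ a
  ∑-𝟙*≤ P? unique a = begin
      ∑[ i < _ ] (𝟙 (P? i) * a)  ≡⟨ sym (*-distribʳ-sum a (𝟙 ∘ P?)) ⟩
      sum (𝟙 ∘ P?) * a           ≤⟨ *-monoˡ-≤ a (sum-𝟙≤1 P? unique) ⟩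
      1 * a                      ≡⟨ *-identityˡ a ⟩
      a                          ∎
    where open ≤-Reasoning

  ∑-∑₂-𝟙*≤ : ∀ {k a b} {R : Fin k → Fin a → Fin b → Set} (R? : ∀ c i j → Dec (R c i j)) →
             (∀ {c c′ i j} → R c i j → R c′ i j → c ≡ c′) → (w : Fin a → Fin b → ℕ) →
             ∑[ c < k ] ∑₂ (λ i j → 𝟙 (R? c i j) * w i j) ≤ ∑₂ w
  ∑-∑₂-𝟙*≤ {k} {a} {b} R? unique w = begin
      ∑[ c < k ] ∑[ i < a ] ∑[ j < b ] (𝟙 (R? c i j) * w i j)
    ≡⟨ ∑-comm (λ c i → ∑[ j < b ] (𝟙 (R? c i j) * w i j)) ⟩
      ∑[ i < a ] ∑[ c < k ] ∑[ j < b ] (𝟙 (R? c i j) * w i j)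
    ≡⟨ sum-cong-≗ (λ i → ∑-comm (λ c j → 𝟙 (R? c i j) * w i j)) ⟩
      ∑[ i < a ] ∑[ j < b ] ∑[ c < k ] (𝟙 (R? c i j) * w i j)
    ≤⟨ sum-mono-≤ (λ i → sum-mono-≤ (λ j → ∑-𝟙*≤ (λ c → R? c i j) unique (w i j))) ⟩
      ∑₂ w
    ∎
    where open ≤-Reasoning

module CauchySchwarz where

  open FiniteSums
  open import Data.Nat using (ℕ; zero; suc; _+_; _*_; _∸_; _≤_; z≤n; _≤?_)
  open import Data.Nat.Properties
  open import Data.Nat.Solver using (module +-*-Solver)
  open import Data.Fin using (Fin; zero; suc)
  open import Function using (_∘_)
  open import Data.Sum using ([_,_]′)
  open import Relation.Nullary using (yes; no; contradiction)
  open import Relation.Binary.PropositionalEquality using (_≡_; refl; sym; cong; cong₂; subst; subst₂)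

  open +-*-Solver

  m*m≤n*n⇒m≤n : ∀ {m n} → m * m ≤ n * n → m ≤ n
  m*m≤n*n⇒m≤n {m} {n} m²≤n² with m ≤? n
  ... | yes m≤n = m≤n
  ... | no  m≰n = contradiction m²≤n² (<⇒≱ (*-mono-< (≰⇒> m≰n) (≰⇒> m≰n)))

  4*[u*v]≤[u+v]*[u+v] : ∀ u v → 4 * (u * v) ≤ (u + v) * (u + v)
  4*[u*v]≤[u+v]*[u+v] u v = [ ordered , (λ v≤u → subst₂ _≤_ (cong (4 *_) (*-comm v u))
                                      (cong₂ _*_ (+-comm v u) (+-comm v u)) (ordered v≤u)) ]′ (≤-total u v)
    where
    ordered : ∀ {u v} → u ≤ v → 4 * (u * v) ≤ (u + v) * (u + v)
    ordered {u} {v} u≤v = subst (λ v → 4 * (u * v) ≤ (u + v) * (u + v)) (m+[n∸m]≡n u≤v)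
      (≤-trans (m≤m+n _ (d * d)) (≤-reflexive (solve 2 (λ u d →
        con 4 :* (u :* (u :+ d)) :+ d :* d := (u :+ (u :+ d)) :* (u :+ (u :+ d))) refl u d)))
      where d = v ∸ u

  -- The cross term is bounded by AM-GM: (2ax)² ≤ 4 (bz)(yc) ≤ (bz + yc)².
  +-pres-square≤* : ∀ a b c x y z → a * a ≤ b * c → x * x ≤ y * z → (a + x) * (a + x) ≤ (b + y) * (c + z)
  +-pres-square≤* a b c x y z a²≤bc x²≤yz = begin
      (a + x) * (a + x)
    ≡⟨ solve 2 (λ a x → (a :+ x) :* (a :+ x) := a :* a :+ (con 2 :* (a :* x) :+ x :* x)) refl a x ⟩
      a * a + (2 * (a * x) + x * x)
    ≤⟨ +-mono-≤ a²≤bc (+-mono-≤ cross x²≤yz) ⟩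
      b * c + ((b * z + y * c) + y * z)
    ≡⟨ solve 4 (λ b c y z → b :* c :+ ((b :* z :+ y :* c) :+ y :* z) := (b :+ y) :* (c :+ z)) refl b c y z ⟩
      (b + y) * (c + z)
    ∎
    where
    open ≤-Reasoning
    cross : 2 * (a * x) ≤ b * z + y * c
    cross = m*m≤n*n⇒m≤n (begin
        2 * (a * x) * (2 * (a * x))
      ≡⟨ solve 2 (λ a x → con 2 :* (a :* x) :* (con 2 :* (a :* x)) := con 4 :* ((a :* a) :* (x :* x))) refl a x ⟩
        4 * ((a * a) * (x * x))
      ≤⟨ *-monoʳ-≤ 4 (*-mono-≤ a²≤bc x²≤yz) ⟩
        4 * ((b * c) * (y * z))
      ≡⟨ cong (4 *_) (solve 4 (λ b c y z → (b :* c) :* (y :* z) := (b :* z) :* (y :* c)) refl b c y z) ⟩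
        4 * ((b * z) * (y * c))
      ≤⟨ 4*[u*v]≤[u+v]*[u+v] (b * z) (y * c) ⟩
        (b * z + y * c) * (b * z + y * c)
      ∎)

  cauchy-schwarz : ∀ {n} (s w q : Fin n → ℕ) → (∀ i → s i * s i ≤ w i * q i) → sum s * sum s ≤ sum w * sum q
  cauchy-schwarz {zero}  s w q s²≤wq = z≤n
  cauchy-schwarz {suc n} s w q s²≤wq =
    +-pres-square≤* (s zero) (w zero) (q zero) _ _ _ (s²≤wq zero) (cauchy-schwarz (s ∘ suc) (w ∘ suc) (q ∘ suc) (s²≤wq ∘ suc))

  triangles : ∀ {a b c} → (Fin a → Fin b → ℕ) → (Fin a → Fin c → ℕ) → (Fin c → Fin b → ℕ) → ℕ
  triangles {a} {b} {c} π α β = ∑[ i < a ] ∑[ j < b ] ∑[ x < c ] (π i j * (α i x * β x j))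

  -- Writing m i j for the number of paths i–x–j,
  -- Cauchy–Schwarz gives T² ≤ ∑π · ∑ π m², and m i j is at most both the α-degree of i and the
  -- β-degree of j.
  triangles-bound : ∀ {a b c} (π : Fin a → Fin b → ℕ) (α : Fin a → Fin c → ℕ) (β : Fin c → Fin b → ℕ) →
    (∀ i j → π i j ≤ 1) → (∀ i x → α i x ≤ 1) → (∀ x j → β x j ≤ 1) →
    triangles π α β * triangles π α β ≤ ∑₂ π * (∑₂ α * ∑₂ β)
  triangles-bound {a} {b} {c} π α β π≤1 α≤1 β≤1 = begin
      triangles π α β * triangles π α β
    ≡⟨ cong (λ t → t * t) T≡ ⟩
      sum S * sum S
    ≤⟨ cauchy-schwarz S W Q (λ i → cauchy-schwarz (λ j → π i j * m i j) (π i) (λ j → π i j * (m i j * m i j))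
         (λ j → ≤-reflexive (solve 2 (λ p m → (p :* m) :* (p :* m) := p :* (p :* (m :* m))) refl (π i j) (m i j)))) ⟩
      sum W * sum Q
    ≤⟨ *-monoʳ-≤ (sum W) ∑Q≤ ⟩
      sum W * (sum degα * sum degβ)
    ≡⟨ cong (λ d → sum W * (sum degα * d)) (∑-comm (λ j x → β x j)) ⟩
      ∑₂ π * (∑₂ α * ∑₂ β)
    ∎
    where
    open ≤-Reasoning
    m : Fin a → Fin b → ℕ
    m i j = ∑[ x < c ] (α i x * β x j)
    degα : Fin a → ℕ
    degα i = ∑[ x < c ] α i x
    degβ : Fin b → ℕ
    degβ j = ∑[ x < c ] β x j
    S W Q : Fin a → ℕ
    S i = ∑[ j < b ] (π i j * m i j)
    W i = ∑[ j < b ] π i j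
    Q i = ∑[ j < b ] (π i j * (m i j * m i j))
    T≡ : triangles π α β ≡ sum S
    T≡ = sum-cong-≗ (λ i → sum-cong-≗ (λ j → sym (*-distribˡ-sum (π i j) (λ x → α i x * β x j))))
    m≤degα : ∀ i j → m i j ≤ degα i
    m≤degα i j = sum-mono-≤ (λ x → ≤-trans (*-monoʳ-≤ (α i x) (β≤1 x j)) (≤-reflexive (*-identityʳ _)))
    m≤degβ : ∀ i j → m i j ≤ degβ j
    m≤degβ i j = sum-mono-≤ (λ x → ≤-trans (*-monoˡ-≤ (β x j) (α≤1 i x)) (≤-reflexive (*-identityˡ _)))
    ∑Q≤ : sum Q ≤ sum degα * sum degβ
    ∑Q≤ = begin
        sum Q
      ≤⟨ sum-mono-≤ (λ i → sum-mono-≤ (λ j →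
           ≤-trans (≤-trans (*-monoˡ-≤ _ (π≤1 i j)) (≤-reflexive (*-identityˡ _)))
                   (*-mono-≤ (m≤degα i j) (m≤degβ i j)))) ⟩
        ∑[ i < a ] ∑[ j < b ] (degα i * degβ j)
      ≡⟨ ∑₂-* degα degβ ⟩
        sum degα * sum degβ
      ∎

module Words where

  open import Data.Nat using (_≤_)
  open FiniteSums
  open import Data.Bool.Properties using () renaming (_≟_ to _≟ᵇ_)
  open import Data.Fin using (Fin)
  open import Data.Fin.Properties using (_≟_)
  open import Data.Vec.Properties using (≡-dec)
  open import Data.List using (List; length)
  open import Data.List.Relation.Unary.Any using (any?)
  open import Data.List.Membership.Propositional using (_∈_)
  open import Data.Product using (_,_)
  open import Relation.Nullary using (Dec; no)
  open import Relation.Nullary.Decidable using (map′; _×-dec_)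
  open import Relation.Binary.Definitions using (DecidableEquality)
  open import Relation.Binary.PropositionalEquality using (refl)

  _≟ʷ_ : ∀ {n} → DecidableEquality (Word n)
  entA i x ≟ʷ entA i′ x′ = map′ (λ { (refl , refl) → refl }) (λ { refl → refl , refl }) (i ≟ i′ ×-dec x ≟ x′)
  entB x j ≟ʷ entB x′ j′ = map′ (λ { (refl , refl) → refl }) (λ { refl → refl , refl }) (x ≟ x′ ×-dec j ≟ j′)
  part i j S ≟ʷ part i′ j′ S′ = map′ (λ { (refl , refl , refl) → refl }) (λ { refl → refl , refl , refl })
                                     (i ≟ i′ ×-dec j ≟ j′ ×-dec ≡-dec _≟ᵇ_ S S′)
  entA _ _   ≟ʷ entB _ _   = no λ ()
  entA _ _   ≟ʷ part _ _ _ = no λ ()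
  entB _ _   ≟ʷ entA _ _   = no λ ()
  entB _ _   ≟ʷ part _ _ _ = no λ ()
  part _ _ _ ≟ʷ entA _ _   = no λ ()
  part _ _ _ ≟ʷ entB _ _   = no λ ()

  _∈ʷ?_ : ∀ {n} (w : Word n) (ws : List (Word n)) → Dec (w ∈ ws)
  w ∈ʷ? ws = any? (w ≟ʷ_) ws

  entA-count≤length : ∀ {n} (ws : List (Word n)) → ∑₂ (λ i x → 𝟙 (entA i x ∈ʷ? ws)) ≤ length ws
  entA-count≤length = ∑₂-𝟙-any≤length (λ i x → entA i x ≟ʷ_)
    (λ w → ∑₂-𝟙≤1 (λ i x → entA i x ≟ʷ w) λ { refl refl → refl , refl })

  entB-count≤length : ∀ {n} (ws : List (Word n)) → ∑₂ (λ x j → 𝟙 (entB x j ∈ʷ? ws)) ≤ length ws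
  entB-count≤length = ∑₂-𝟙-any≤length (λ x j → entB x j ≟ʷ_)
    (λ w → ∑₂-𝟙≤1 (λ x j → entB x j ≟ʷ w) λ { refl refl → refl , refl })

module LowerBound where

  open FiniteSums
  open CauchySchwarz
  open Words
  open import Data.Nat using (ℕ; zero; suc; _+_; _*_; _≤_; z≤n)
  open import Data.Nat.Properties hiding (_≟_)
  open import Data.Nat.Solver using (module +-*-Solver)
  open import Data.Fin using (Fin)
  open import Data.Fin.Properties using (_≟_; any?)
  open import Data.Fin.Subset using () renaming (_∈_ to _∈ₛ_)
  open import Data.Fin.Subset.Properties using (x∈⁅y⁆⇒x≡y; x∈p∪q⁻; ∈⊤) renaming (_∈?_ to _∈ₛ?_)
  open import Data.List using (List; length)
  open import Data.List.Relation.Unary.Any as Any using (Any)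
  open import Data.List.Membership.Propositional using (_∈_; find; lose)
  open import Data.Empty using (⊥; ⊥-elim)
  open import Data.Product using (∃; _×_; _,_)
  open import Data.Sum using (_⊎_; inj₁; inj₂)
  open import Relation.Nullary using (Dec; yes; no; ¬_; ¬?)
  open import Relation.Nullary.Decidable using (_×-dec_)
  open import Relation.Binary.PropositionalEquality using (_≡_; refl; sym; trans; cong; cong₂; subst₂)

  open +-*-Solver

  module _ {n : ℕ} where

    Contains : Fin n → Fin n → Fin n → Word n → Set
    Contains i x j (entA _ _)     = ⊥
    Contains i x j (entB _ _)     = ⊥
    Contains i x j (part i′ j′ S) = i ≡ i′ × j ≡ j′ × x ∈ₛ S

    contains? : ∀ i x j w → Dec (Contains i x j w)
    contains? i x j (entA _ _)     = no λ ()
    contains? i x j (entB _ _)     = no λ ()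
    contains? i x j (part i′ j′ S) = i ≟ i′ ×-dec j ≟ j′ ×-dec x ∈ₛ? S

    -- Over a general semiring a term is never created by additions: it is multiplied from two held
    -- factors or it was already inside a held word.
    derivable-contains : ∀ {held i x j w} → Derivable held w → Contains i x j w →
                         (entA i x ∈ held × entB x j ∈ held) ⊎ Any (Contains i x j) held
    derivable-contains (hold w∈) contains = inj₂ (lose w∈ contains)
    derivable-contains (mul {x = y} a∈ b∈) (refl , refl , x∈⁅y⁆) with x∈⁅y⁆⇒x≡y y x∈⁅y⁆
    ... | refl = inj₁ (a∈ , b∈)
    derivable-contains (add {S = S} {T} dS dT _) (refl , refl , x∈S∪T) with x∈p∪q⁻ S T x∈S∪T
    ... | inj₁ x∈S = derivable-contains dS (refl , refl , x∈S)
    ... | inj₂ x∈T = derivable-contains dT (refl , refl , x∈T)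

    Computed : Config n → Fin n → Fin n → Fin n → Set
    Computed s i x j = ∃ λ p → Any (Contains i x j) (s p)

    computed? : ∀ s i x j → Dec (Computed s i x j)
    computed? s i x j = any? (λ p → Any.any? (contains? i x j) (s p))

    uncomputed : Config n → ℕ
    uncomputed s = ∑[ i < n ] ∑[ j < n ] ∑[ x < n ] 𝟙 (¬? (computed? s i x j))

    PartOf : Fin n → Fin n → Word n → Set
    PartOf i j (entA _ _)     = ⊥
    PartOf i j (entB _ _)     = ⊥
    PartOf i j (part i′ j′ _) = i ≡ i′ × j ≡ j′

    partOf? : ∀ i j w → Dec (PartOf i j w)
    partOf? i j (entA _ _)     = no λ ()
    partOf? i j (entB _ _)     = no λ ()
    partOf? i j (part i′ j′ _) = i ≟ i′ ×-dec j ≟ j′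

    contains⇒partOf : ∀ {i x j} w → Contains i x j w → PartOf i j w
    contains⇒partOf (part _ _ _) (i≡ , j≡ , _) = i≡ , j≡

    -- Bounds the terms that local computation from `held` can newly put into the words of `out`:
    -- the triangles i–x–j with a_ix and b_xj held and some partial sum of c_ij in `out`.
    newTerms : List (Word n) → List (Word n) → ℕ
    newTerms held out = triangles (λ i j → 𝟙 (Any.any? (partOf? i j) out))
                                  (λ i x → 𝟙 (entA i x ∈ʷ? held)) (λ x j → 𝟙 (entB x j ∈ʷ? held))

    round-uncomputed : ∀ {M s s′} (r : Round M s s′) →
                       uncomputed s ≤ uncomputed s′ + ∑[ q < n ] newTerms (s q) (Round.L r q)
    round-uncomputed {s = s} {s′} r = begin
        uncomputed s
      ≤⟨ sum-mono-≤ (λ i → sum-mono-≤ (λ j → sum-mono-≤ (λ x → pointwise i x j))) ⟩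
        ∑[ i < n ] ∑[ j < n ] ∑[ x < n ] (𝟙 (¬? (computed? s′ i x j)) + ∑[ q < n ] new q i x j)
      ≡⟨ ∑₃-distrib-+ (λ i j x → 𝟙 (¬? (computed? s′ i x j))) (λ i j x → ∑[ q < n ] new q i x j) ⟩
        uncomputed s′ + ∑[ i < n ] ∑[ j < n ] ∑[ x < n ] ∑[ q < n ] new q i x j
      ≡⟨ cong (uncomputed s′ +_) processors-outermost ⟩
        uncomputed s′ + ∑[ q < n ] newTerms (s q) (L q)
      ∎
      where
      open ≤-Reasoning
      open Round r
      new : Fin n → Fin n → Fin n → Fin n → ℕ
      new q i x j = 𝟙 (Any.any? (partOf? i j) (L q)) * (𝟙 (entA i x ∈ʷ? s q) * 𝟙 (entB x j ∈ʷ? s q))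
      ∑₃-distrib-+ : ∀ (f g : Fin n → Fin n → Fin n → ℕ) →
                     ∑[ i < n ] ∑[ j < n ] ∑[ x < n ] (f i j x + g i j x) ≡
                     ∑[ i < n ] ∑[ j < n ] ∑[ x < n ] f i j x + ∑[ i < n ] ∑[ j < n ] ∑[ x < n ] g i j x
      ∑₃-distrib-+ f g = trans (sum-cong-≗ (λ i → trans (sum-cong-≗ (λ j → ∑-distrib-+ (f i j) (g i j)))
                                                        (∑-distrib-+ (λ j → ∑[ x < n ] f i j x) _)))
                               (∑-distrib-+ (λ i → ∑[ j < n ] ∑[ x < n ] f i j x) _)
      processors-outermost : ∑[ i < n ] ∑[ j < n ] ∑[ x < n ] ∑[ q < n ] new q i x j ≡ ∑[ q < n ] newTerms (s q) (L q)
      processors-outermost = begin-equality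
          ∑[ i < n ] ∑[ j < n ] ∑[ x < n ] ∑[ q < n ] new q i x j
        ≡⟨ sum-cong-≗ (λ i → sum-cong-≗ (λ j → ∑-comm (λ x q → new q i x j))) ⟩
          ∑[ i < n ] ∑[ j < n ] ∑[ q < n ] ∑[ x < n ] new q i x j
        ≡⟨ sum-cong-≗ (λ i → ∑-comm (λ j q → ∑[ x < n ] new q i x j)) ⟩
          ∑[ i < n ] ∑[ q < n ] ∑[ j < n ] ∑[ x < n ] new q i x j
        ≡⟨ ∑-comm (λ i q → ∑[ j < n ] ∑[ x < n ] new q i x j) ⟩
          ∑[ q < n ] newTerms (s q) (L q)
        ∎
      pointwise : ∀ i x j → 𝟙 (¬? (computed? s i x j)) ≤ 𝟙 (¬? (computed? s′ i x j)) + ∑[ q < n ] new q i x j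
      pointwise i x j with computed? s i x j
      ... | yes _ = z≤n
      ... | no not-computed with computed? s′ i x j
      ...   | no _ = m≤m+n 1 _
      ...   | yes (p , contains∈s′) = from-output (find contains∈s′)
        where
        from-local : ∀ {w} q → w ∈ L q → Contains i x j w → 1 ≤ ∑[ q < n ] new q i x j
        from-local {w} q w∈L contains with derivable-contains (local q w∈L) contains
        ... | inj₂ earlier    = ⊥-elim (not-computed (q , earlier))
        ... | inj₁ (a∈ , b∈) = ≤-trans (≤-reflexive (sym new≡1)) (≤-sum (λ q → new q i x j) q)
          where
          new≡1 : new q i x j ≡ 1
          new≡1 = trans (cong₂ _*_ (𝟙-yes (Any.any? (partOf? i j) (L q)) (lose w∈L (contains⇒partOf w contains)))
                                    (cong₂ _*_ (𝟙-yes (entA i x ∈ʷ? s q) a∈) (𝟙-yes (entB x j ∈ʷ? s q) b∈))) refl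
        from-output : (∃ λ w → w ∈ s′ p × Contains i x j w) → 1 ≤ ∑[ q < n ] new q i x j
        from-output (w , w∈s′ , contains) with newOk p w∈s′
        ... | inj₁ w∈L       = from-local p w∈L contains
        ... | inj₂ (q , w∈m) = from-local q (sendOk q p w∈m) contains

    newTerms-bound : ∀ {B} held out → length held ≤ B → length out ≤ B →
                     newTerms held out * newTerms held out ≤ B * (B * B)
    newTerms-bound held out held≤B out≤B =
      ≤-trans (triangles-bound π α β (λ i j → 𝟙≤1 _) (λ i x → 𝟙≤1 _) (λ x j → 𝟙≤1 _))
              (*-mono-≤ (≤-trans parts≤ out≤B)
                        (*-mono-≤ (≤-trans (entA-count≤length held) held≤B) (≤-trans (entB-count≤length held) held≤B)))
      where
      π = λ i j → 𝟙 (Any.any? (partOf? i j) out)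
      α = λ i x → 𝟙 (entA i x ∈ʷ? held)
      β = λ x j → 𝟙 (entB x j ∈ʷ? held)
      partOf-unique : ∀ w {i j i′ j′} → PartOf i j w → PartOf i′ j′ w → i ≡ i′ × j ≡ j′
      partOf-unique (part _ _ _) (refl , refl) (refl , refl) = refl , refl
      parts≤ : ∑₂ π ≤ length out
      parts≤ = ∑₂-𝟙-any≤length partOf? (λ w → ∑₂-𝟙≤1 (λ i j → partOf? i j w) (partOf-unique w)) out

    round-newTerms-bound : ∀ {B} (held out : Fin n → List (Word n)) →
                           (∀ q → length (held q) ≤ B) → (∀ q → length (out q) ≤ B) →
                           let Y = ∑[ q < n ] newTerms (held q) (out q) in Y * Y ≤ n * (n * (B * (B * B)))
    round-newTerms-bound {B} held out held≤B out≤B =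
      subst₂ (λ u v → Y * Y ≤ u * v) (trans (sum-const n 1) (*-identityʳ n)) (sum-const n (B * (B * B)))
        (cauchy-schwarz (λ q → newTerms (held q) (out q)) (λ _ → 1) (λ _ → B * (B * B))
          (λ q → ≤-trans (newTerms-bound (held q) (out q) (held≤B q) (out≤B q)) (≤-reflexive (sym (*-identityˡ _)))))
      where Y = ∑[ q < n ] newTerms (held q) (out q)

    uncomputed-output : ∀ {s} → Output s → uncomputed s ≡ 0
    uncomputed-output {s} output = sum-zero λ i → sum-zero λ j → sum-zero λ x →
      𝟙-no (¬? (computed? s i x j)) λ not-computed →
        let p , c∈ = output i j in not-computed (p , lose c∈ (refl , refl , ∈⊤))

    -- The R remaining rounds each add at most √(n · n B³) terms, and these square roots add up.
    run-uncomputed : ∀ {B M s R} → M ≤ B → (∀ p → length (s p) ≤ B) → Run M s R →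
                     uncomputed s * uncomputed s ≤ (R * n) * ((R * n) * (B * (B * B)))
    run-uncomputed M≤B s≤B (done output) rewrite uncomputed-output output = z≤n
    run-uncomputed {B} {s = s} {suc R} M≤B s≤B (step {s' = s′} r run) = begin
        uncomputed s * uncomputed s
      ≤⟨ *-mono-≤ unc≤ unc≤ ⟩
        (Y + uncomputed s′) * (Y + uncomputed s′)
      ≤⟨ +-pres-square≤* Y n (n * B³) (uncomputed s′) (R * n) ((R * n) * B³)
           (round-newTerms-bound s (Round.L r) s≤B (λ q → ≤-trans (Round.locMem r q) M≤B))
           (run-uncomputed M≤B (λ p → ≤-trans (Round.newMem r p) M≤B) run) ⟩
        (n + R * n) * (n * B³ + (R * n) * B³)
      ≡⟨ cong ((n + R * n) *_) (sym (*-distribʳ-+ B³ n (R * n))) ⟩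
        (suc R * n) * ((suc R * n) * B³)
      ∎
      where
      open ≤-Reasoning
      B³ = B * (B * B)
      Y = ∑[ q < n ] newTerms (s q) (Round.L r q)
      unc≤ : uncomputed s ≤ Y + uncomputed s′
      unc≤ = ≤-trans (round-uncomputed r) (≤-reflexive (+-comm (uncomputed s′) Y))

    uncomputed-initial : ∀ {s₀} → InitialDist n s₀ → uncomputed s₀ ≡ n * (n * n)
    uncomputed-initial {s₀} (inputs , _ , _) =
      trans (sum-cong-≗ λ i → trans (sum-cong-≗ (row≡n i)) (sum-const n n)) (sum-const n (n * n))
      where
      input-contains-nothing : ∀ {i x j w} → IsInput w → ¬ Contains i x j w
      input-contains-nothing (inA _ _) ()
      input-contains-nothing (inB _ _) ()
      nothing-computed : ∀ i x j → ¬ Computed s₀ i x j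
      nothing-computed i x j (p , c∈) = let w , w∈ , c = find c∈ in input-contains-nothing (inputs p w∈) c
      row≡n : ∀ i j → ∑[ x < n ] 𝟙 (¬? (computed? s₀ i x j)) ≡ n
      row≡n i j = trans (sum-cong-≗ λ x → 𝟙-yes (¬? (computed? s₀ i x j)) (nothing-computed i x j))
                        (trans (sum-const n 1) (*-identityʳ n))

  lower-bound : ∀ c → ∃ λ k → ∀ n (s₀ : Config n) → InitialDist n s₀ →
                ∀ R → Run (c * n) s₀ R → n ≤ k * (R * R)
  lower-bound c = (c + 2) * ((c + 2) * (c + 2)) , bound
    where
    bound : ∀ n (s₀ : Config n) → InitialDist n s₀ → ∀ R → Run (c * n) s₀ R → n ≤ (c + 2) * ((c + 2) * (c + 2)) * (R * R)
    bound zero          s₀ initial R run = z≤n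
    bound n@(suc _) s₀ initial@(_ , s₀-length , _) R run =
      *-cancelʳ-≤ n ((c + 2) * ((c + 2) * (c + 2)) * (R * R)) (n * (n * (n * (n * n)))) (begin
        n * (n * (n * (n * (n * n))))
      ≡⟨ solve 1 (λ n → n :* (n :* (n :* (n :* (n :* n)))) := (n :* (n :* n)) :* (n :* (n :* n))) refl n ⟩
        (n * (n * n)) * (n * (n * n))
      ≡⟨ cong (λ u → u * u) (sym (uncomputed-initial initial)) ⟩
        uncomputed s₀ * uncomputed s₀
      ≤⟨ run-uncomputed (*-monoˡ-≤ n (m≤m+n c 2))
                        (λ p → ≤-trans (≤-reflexive (s₀-length p)) (*-monoˡ-≤ n (m≤n+m 2 c))) run ⟩
        (R * n) * ((R * n) * (((c + 2) * n) * (((c + 2) * n) * ((c + 2) * n))))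
      ≡⟨ solve 3 (λ c n R → (R :* n) :* ((R :* n) :* (((c :+ con 2) :* n) :* (((c :+ con 2) :* n) :* ((c :+ con 2) :* n)))) :=
                            (c :+ con 2) :* ((c :+ con 2) :* (c :+ con 2)) :* (R :* R) :* (n :* (n :* (n :* (n :* n))))) refl c n R ⟩
        (c + 2) * ((c + 2) * (c + 2)) * (R * R) * (n * (n * (n * (n * n))))
      ∎)
      where open ≤-Reasoning

module Modular where

  open import Data.Nat using (ℕ; _+_; _∸_; _<_; NonZero)
  open import Data.Nat.Properties
  open import Data.Nat.DivMod
  open import Relation.Binary.PropositionalEquality using (_≡_; sym; trans; cong; module ≡-Reasoning)

  module _ (m : ℕ) .{{_ : NonZero m}} where

    [a%m+b]%m≡[a+b]%m : ∀ a b → (a % m + b) % m ≡ (a + b) % m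
    [a%m+b]%m≡[a+b]%m a b = begin
        (a % m + b) % m         ≡⟨ %-distribˡ-+ (a % m) b m ⟩
        (a % m % m + b % m) % m ≡⟨ cong (λ u → (u + b % m) % m) (m%n%n≡m%n a m) ⟩
        (a % m + b % m) % m     ≡⟨ %-distribˡ-+ a b m ⟨
        (a + b) % m             ∎
      where open ≡-Reasoning

    [a+b%m]%m≡[a+b]%m : ∀ a b → (a + b % m) % m ≡ (a + b) % m
    [a+b%m]%m≡[a+b]%m a b = trans (cong (_% m) (+-comm a (b % m)))
                                   (trans ([a%m+b]%m≡[a+b]%m b a) (cong (_% m) (+-comm b a)))

    [r+a+[m∸a]]%m≡r%m : ∀ {a} r → a < m → (r + a + (m ∸ a)) % m ≡ r % m
    [r+a+[m∸a]]%m≡r%m {a} r a<m = begin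
        (r + a + (m ∸ a)) % m   ≡⟨ cong (_% m) (+-assoc r a (m ∸ a)) ⟩
        (r + (a + (m ∸ a))) % m ≡⟨ cong (λ u → (r + u) % m) (m+[n∸m]≡n (<⇒≤ a<m)) ⟩
        (r + m) % m             ≡⟨ [m+n]%n≡m%n r m ⟩
        r % m                   ∎
      where open ≡-Reasoning

    +-∸-inverse : ∀ {a} r → a < m → ((r + a) % m + (m ∸ a)) % m ≡ r % m
    +-∸-inverse {a} r a<m = trans ([a%m+b]%m≡[a+b]%m (r + a) (m ∸ a)) ([r+a+[m∸a]]%m≡r%m r a<m)

    ∸-+-inverse : ∀ {a} r → a < m → (a + (r + (m ∸ a)) % m) % m ≡ r % m
    ∸-+-inverse {a} r a<m = begin
        (a + (r + (m ∸ a)) % m) % m ≡⟨ [a+b%m]%m≡[a+b]%m a (r + (m ∸ a)) ⟩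
        (a + (r + (m ∸ a))) % m     ≡⟨ cong (_% m) (trans (sym (+-assoc a r _)) (cong (_+ (m ∸ a)) (+-comm a r))) ⟩
        (r + a + (m ∸ a)) % m       ≡⟨ [r+a+[m∸a]]%m≡r%m r a<m ⟩
        r % m                       ∎
      where open ≡-Reasoning

    +-%-cancelʳ : ∀ {a b t} → t < m → (a + t) % m ≡ (b + t) % m → a % m ≡ b % m
    +-%-cancelʳ {a} {b} {t} t<m eq = begin
        a % m                       ≡⟨ +-∸-inverse a t<m ⟨
        ((a + t) % m + (m ∸ t)) % m ≡⟨ cong (λ u → (u + (m ∸ t)) % m) eq ⟩
        ((b + t) % m + (m ∸ t)) % m ≡⟨ +-∸-inverse b t<m ⟩
        b % m                       ∎
      where open ≡-Reasoning

    +-%-injectiveˡ : ∀ {a b t} → a < m → b < m → t < m → (a + t) % m ≡ (b + t) % m → a ≡ b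
    +-%-injectiveˡ a<m b<m t<m eq =
      trans (sym (m<n⇒m%n≡m a<m)) (trans (+-%-cancelʳ t<m eq) (m<n⇒m%n≡m b<m))

    +-%-injectiveʳ : ∀ {a b t} → a < m → b < m → t < m → (t + a) % m ≡ (t + b) % m → a ≡ b
    +-%-injectiveʳ {a} {b} {t} a<m b<m t<m eq =
      +-%-injectiveˡ a<m b<m t<m (trans (cong (_% m) (+-comm a t)) (trans eq (cong (_% m) (+-comm t b))))

module Accumulation where

  open import Data.Bool using (true)
  open import Data.Fin using (Fin; zero; suc)
  open import Data.Fin.Properties using (_≟_)
  open import Data.Fin.Subset using (Subset; _∈_; _∉_; _⊆_; _⊂_; _∪_; _-_; ⁅_⁆; Nonempty)
  open import Data.Fin.Subset.Properties
    using (⊆-antisym; x∈p∪q⁻; x∈p∪q⁺; x∈p∩q⁻; x∈⁅x⁆; x∈⁅y⁆⇒x≡y; x∈p∧x≢y⇒x∈p-y; p─q⊆p; x∈p⇒p-x⊂p;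
           nonempty?; Empty-unique; ∪-identityˡ)
  open import Data.Fin.Subset.Induction using (Acc; acc; ⊂-wellFounded)
  open import Data.Vec using (_∷_; tabulate; there)
  open import Data.Vec.Properties using (lookup∘tabulate; []=⇒lookup; lookup⇒[]=)
  open import Data.List using (List)
  open import Data.List.Membership.Propositional using () renaming (_∈_ to _∈ᴸ_)
  open import Data.Product using (_×_; _,_)
  open import Data.Sum using (inj₁; inj₂)
  open import Relation.Nullary using (Dec; yes; no; does)
  open import Relation.Nullary.Decidable using (dec-true)
  open import Relation.Binary.PropositionalEquality using (_≡_; refl; sym; trans; subst)

  subset : ∀ {n} {P : Fin n → Set} → (∀ x → Dec (P x)) → Subset n
  subset P? = tabulate (λ x → does (P? x))

  ∈-subset⁺ : ∀ {n} {P : Fin n → Set} (P? : ∀ x → Dec (P x)) {x} → P x → x ∈ subset P?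
  ∈-subset⁺ P? {x} p = lookup⇒[]= x _ (trans (lookup∘tabulate _ x) (dec-true (P? x) p))

  ∈-subset⁻ : ∀ {n} {P : Fin n → Set} (P? : ∀ x → Dec (P x)) {x} → x ∈ subset P? → P x
  ∈-subset⁻ P? {x} x∈ = witness (P? x) (trans (sym (lookup∘tabulate _ x)) ([]=⇒lookup x∈))
    where
    witness : ∀ {A : Set} (a? : Dec A) → does a? ≡ true → A
    witness (yes a) _ = a

  x∉p-x : ∀ {n} (p : Subset n) {x} → x ∉ p - x
  x∉p-x (_ ∷ p) {zero}  ()
  x∉p-x (_ ∷ p) {suc x} (there x∈) = x∉p-x p x∈

  p-x∪⁅x⁆≡p : ∀ {n} {p : Subset n} {x} → x ∈ p → (p - x) ∪ ⁅ x ⁆ ≡ p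
  p-x∪⁅x⁆≡p {p = p} {x} x∈p = ⊆-antisym ⊆p p⊆
    where
    ⊆p : (p - x) ∪ ⁅ x ⁆ ⊆ p
    ⊆p y∈ with x∈p∪q⁻ (p - x) ⁅ x ⁆ y∈
    ... | inj₁ y∈p-x = p─q⊆p p ⁅ x ⁆ y∈p-x
    ... | inj₂ y∈⁅x⁆ rewrite x∈⁅y⁆⇒x≡y x y∈⁅x⁆ = x∈p
    p⊆ : p ⊆ (p - x) ∪ ⁅ x ⁆
    p⊆ {y} y∈p with y ≟ x
    ... | yes refl = x∈p∪q⁺ (inj₂ (x∈⁅x⁆ x))
    ... | no y≢x   = x∈p∪q⁺ (inj₁ (x∈p∧x≢y⇒x∈p-y y∈p y≢x))

  derivable-part : ∀ {n} {held : List (Word n)} {i j} (S : Subset n) → Nonempty S →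
                   (∀ {x} → x ∈ S → entA i x ∈ᴸ held × entB x j ∈ᴸ held) → Derivable held (part i j S)
  derivable-part {held = held} {i} {j} S = go S (⊂-wellFounded S)
    where
    go : ∀ S → Acc _⊂_ S → Nonempty S → (∀ {x} → x ∈ S → entA i x ∈ᴸ held × entB x j ∈ᴸ held) →
         Derivable held (part i j S)
    go S (acc rec) (x , x∈S) factors =
      subst (λ S → Derivable held (part i j S)) (p-x∪⁅x⁆≡p x∈S) (rest-and-x (nonempty? (S - x)))
      where
      single : Derivable held (part i j ⁅ x ⁆)
      single = let a∈ , b∈ = factors x∈S in mul a∈ b∈
      rest-and-x : Dec (Nonempty (S - x)) → Derivable held (part i j ((S - x) ∪ ⁅ x ⁆))
      rest-and-x (yes rest) = add (go (S - x) (rec (x∈p⇒p-x⊂p x∈S)) rest (λ y∈ → factors (p─q⊆p S ⁅ x ⁆ y∈))) single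
                                  (λ (y , y∈) → let y∈S-x , y∈⁅x⁆ = x∈p∩q⁻ (S - x) ⁅ x ⁆ y∈ in
                                                x∉p-x S (subst (_∈ S - x) (x∈⁅y⁆⇒x≡y x y∈⁅x⁆) y∈S-x))
      rest-and-x (no empty) rewrite Empty-unique empty | ∪-identityˡ ⁅ x ⁆ = single

module Selection where

  open FiniteSums
  open import Data.Nat using (ℕ; zero; suc; _+_)
  open import Data.Fin using (Fin; zero; suc)
  open import Data.List using (List; []; _∷_; concat; tabulate; length; map; allFin)
  open import Data.List.Properties using (length-++)
  open import Data.List.Relation.Unary.Any using (here)
  open import Data.List.Relation.Unary.Any.Properties using (tabulate⁺; tabulate⁻)
  open import Data.List.Membership.Propositional using (_∈_)
  open import Data.List.Membership.Propositional.Properties using (∈-concat⁺; ∈-concat⁻)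
  import Data.Nat.ListAction as List
  open import Data.Product using (∃; ∃₂; _×_; _,_)
  open import Function using (_∘_)
  open import Relation.Nullary using (Dec; yes; no; contradiction)
  open import Relation.Binary.PropositionalEquality using (_≡_; refl; trans; cong)

  only : ∀ {A P : Set} → Dec P → A → List A
  only (yes _) a = a ∷ []
  only (no _)  a = []

  length-concat-tabulate : ∀ {A : Set} {k} (xss : Fin k → List A) → length (concat (tabulate xss)) ≡ ∑[ i < k ] length (xss i)
  length-concat-tabulate {k = zero}  xss = refl
  length-concat-tabulate {k = suc k} xss = trans (length-++ (xss zero)) (cong (length (xss zero) +_) (length-concat-tabulate (xss ∘ suc)))

  ∈-concat-tabulate⁺ : ∀ {A : Set} {k} {xss : Fin k → List A} {w} i → w ∈ xss i → w ∈ concat (tabulate xss)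
  ∈-concat-tabulate⁺ i w∈ = ∈-concat⁺ (tabulate⁺ i w∈)

  ∈-concat-tabulate⁻ : ∀ {A : Set} {k} {xss : Fin k → List A} {w} → w ∈ concat (tabulate xss) → ∃ λ i → w ∈ xss i
  ∈-concat-tabulate⁻ w∈ = tabulate⁻ (∈-concat⁻ _ w∈)

  module _ {A : Set} {a b} {P : Fin a → Fin b → Set} (P? : ∀ i j → Dec (P i j)) (f : Fin a → Fin b → A) where

    select : List A
    select = concat (tabulate λ i → concat (tabulate λ j → only (P? i j) (f i j)))

    length-select : length select ≡ ∑₂ (λ i j → 𝟙 (P? i j))
    length-select = trans (length-concat-tabulate (λ i → concat (tabulate λ j → only (P? i j) (f i j))))
                          (sum-cong-≗ λ i → trans (length-concat-tabulate (λ j → only (P? i j) (f i j)))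
                                                  (sum-cong-≗ λ j → length-only (P? i j)))
      where
      length-only : ∀ {Q : Set} {v : A} (d : Dec Q) → length (only d v) ≡ 𝟙 d
      length-only (yes _) = refl
      length-only (no _)  = refl

    ∈-select⁺ : ∀ {i j} → P i j → f i j ∈ select
    ∈-select⁺ {i} {j} p = ∈-concat-tabulate⁺ i (∈-concat-tabulate⁺ j (∈-only (P? i j)))
      where
      ∈-only : (d : Dec (P i j)) → f i j ∈ only d (f i j)
      ∈-only (yes _) = here refl
      ∈-only (no ¬p) = contradiction p ¬p

    ∈-select⁻ : ∀ {w} → w ∈ select → ∃₂ λ i j → P i j × w ≡ f i j
    ∈-select⁻ w∈ = let i , w∈ᵢ = ∈-concat-tabulate⁻ w∈ ; j , w∈ᵢⱼ = ∈-concat-tabulate⁻ w∈ᵢ in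
                   i , j , only⁻ (P? i j) w∈ᵢⱼ
      where
      only⁻ : ∀ {Q : Set} {w v} (d : Dec Q) → w ∈ only d v → Q × w ≡ v
      only⁻ (yes q) (here w≡v) = q , w≡v

  sum-map-tabulate : ∀ {A : Set} {n} (f : A → ℕ) (g : Fin n → A) → List.sum (map f (tabulate g)) ≡ ∑[ i < n ] f (g i)
  sum-map-tabulate {n = zero}  f g = refl
  sum-map-tabulate {n = suc n} f g = cong (f (g zero) +_) (sum-map-tabulate f (g ∘ suc))

  sum-map-allFin : ∀ {n} (f : Fin n → ℕ) → List.sum (map f (allFin n)) ≡ sum f
  sum-map-allFin f = sum-map-tabulate f (λ i → i)

module UpperBound where

  open FiniteSums
  open Words
  open Modular
  open Accumulation
  open Selection
  open import Data.Nat using (ℕ; zero; suc; pred; _+_; _*_; _∸_; _≤_; _<_; z≤n; s≤s; NonZero; >-nonZero⁻¹; _<?_; _≤?_)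
    renaming (_≟_ to _≟ℕ_)
  open import Data.Nat.Properties hiding (_≟_)
  open import Data.Nat.DivMod
  open import Data.Nat.Solver using (module +-*-Solver)
  open import Data.Fin using (Fin; toℕ; fromℕ<)
  open import Data.Fin.Properties using (toℕ-injective; toℕ-fromℕ<; toℕ<n; _≟_)
  open import Data.Fin.Subset using (Subset; ⊤; ⊥; _∪_; _∩_; _⊆_; Empty; Nonempty) renaming (_∈_ to _∈ₛ_)
  open import Data.Fin.Subset.Properties using (⊆-antisym; Empty-unique; x∈p∪q⁺; x∈p∪q⁻; x∈p∩q⁻; ∪-identityˡ; ∈⊤)
  open import Data.List using (List; []; _++_; length)
  open import Data.List.Properties using (length-++; ++-identityʳ)
  open import Data.List.Membership.Propositional using (_∈_)
  open import Data.List.Membership.Propositional.Properties using (∈-++⁺ˡ; ∈-++⁺ʳ; ∈-++⁻)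
  open import Data.Product using (∃; ∃₂; _×_; _,_; proj₁; proj₂)
  open import Data.Sum using (_⊎_; inj₁; inj₂)
  open import Relation.Nullary using (Dec; yes; no)
  open import Relation.Nullary.Decidable using (_×-dec_)
  open import Relation.Binary.PropositionalEquality

  open +-*-Solver

  module Cannon (n m : ℕ) .{{_ : NonZero m}} (m*m≤n : m * m ≤ n) (n<[m+1]² : n < suc m * suc m)
                (s₀ : Config n) (initial : InitialDist n s₀) where

    block row col : Fin n → ℕ
    block x = toℕ x % m
    row p = toℕ p / m
    col p = toℕ p % m

    OnGrid : Fin n → Set
    OnGrid p = toℕ p < m * m

    block<m : ∀ x → block x < m
    block<m x = m%n<n (toℕ x) m

    col<m : ∀ p → col p < m
    col<m p = m%n<n (toℕ p) m

    row<m : ∀ {p} → OnGrid p → row p < m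
    row<m = m<n*o⇒m/o<n

    position : ∀ p → toℕ p ≡ col p + row p * m
    position p = m≡m%n+[m/n]*n (toℕ p) m

    position-injective : ∀ {p p′} → row p ≡ row p′ → col p ≡ col p′ → p ≡ p′
    position-injective {p} {p′} row≡ col≡ =
      toℕ-injective (trans (position p) (trans (cong₂ (λ c r → c + r * m) col≡ row≡) (sym (position p′))))

    -- The t < m with (col p + t) mod m = block x: the stage in which p uses a_ix and b_xj.
    stage : Fin n → Fin n → ℕ
    stage p x = (block x + (m ∸ col p)) % m

    stage<m : ∀ p x → stage p x < m
    stage<m p x = m%n<n _ m

    col+stage : ∀ p x → (col p + stage p x) % m ≡ block x
    col+stage p x = trans (∸-+-inverse m (block x) (col<m p)) (m%n%n≡m%n (toℕ x) m)

    stage-≡ : ∀ {p x t} → t < m → (col p + t) % m ≡ block x → stage p x ≡ t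
    stage-≡ {p} {x} t<m col+t≡ = +-%-injectiveʳ m (stage<m p x) t<m (col<m p) (trans (col+stage p x) (sym col+t≡))

    col-from-stage : ∀ {p p′ x t} → stage p x ≡ t → stage p′ x ≡ t → col p ≡ col p′
    col-from-stage {p} {p′} {x} refl stage′≡ = +-%-injectiveˡ m (col<m p) (col<m p′) (stage<m p x)
      (trans (col+stage p x) (trans (sym (col+stage p′ x)) (cong (λ t → (col p′ + t) % m) stage′≡)))

    Owns : Fin n → Fin n → Fin n → Set
    Owns p i j = OnGrid p × block i ≡ row p × block j ≡ (row p + col p) % m

    NeedsA : ℕ → Fin n → Fin n → Fin n → Set
    NeedsA t p i x = OnGrid p × block i ≡ row p × stage p x ≡ t

    NeedsB : ℕ → Fin n → Fin n → Fin n → Set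
    NeedsB t p x j = OnGrid p × block j ≡ (row p + col p) % m × stage p x ≡ t

    owns? : ∀ p i j → Dec (Owns p i j)
    owns? p i j = toℕ p <? m * m ×-dec block i ≟ℕ row p ×-dec block j ≟ℕ (row p + col p) % m

    needsA? : ∀ t p i x → Dec (NeedsA t p i x)
    needsA? t p i x = toℕ p <? m * m ×-dec block i ≟ℕ row p ×-dec stage p x ≟ℕ t

    needsB? : ∀ t p x j → Dec (NeedsB t p x j)
    needsB? t p x j = toℕ p <? m * m ×-dec block j ≟ℕ (row p + col p) % m ×-dec stage p x ≟ℕ t

    needsA-unique : ∀ {t p p′ i x} → NeedsA t p i x → NeedsA t p′ i x → p ≡ p′
    needsA-unique (_ , row≡ , stage≡) (_ , row′≡ , stage′≡) =
      position-injective (trans (sym row≡) row′≡) (col-from-stage stage≡ stage′≡)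

    needsB-unique : ∀ {t p p′ x j} → NeedsB t p x j → NeedsB t p′ x j → p ≡ p′
    needsB-unique {p = p} {p′} (grid , diag≡ , stage≡) (grid′ , diag′≡ , stage′≡) =
      position-injective (+-%-injectiveˡ m (row<m grid) (row<m grid′) (col<m p)
                            (trans (sym diag≡) (trans diag′≡ (cong (λ c → (row p′ + c) % m) (sym col≡)))))
                         col≡
      where col≡ = col-from-stage stage≡ stage′≡

    D : ℕ
    D = suc (n / m)

    -- A block has at most D indices, since x ↦ x / m is injective on it.
    same-block-count : ∀ {P : Fin n → Set} (P? : ∀ x → Dec (P x)) →
                 (∀ {x x′} → P x → P x′ → block x ≡ block x′) → ∑[ x < n ] 𝟙 (P? x) ≤ D
    same-block-count P? same-block = sum-𝟙≤-injection P? D (λ x → toℕ x / m)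
      (λ x _ → s≤s (/-monoˡ-≤ m (<⇒≤ (toℕ<n x))))
      (λ {x} {x′} px px′ quotient≡ → toℕ-injective (begin
        toℕ x                      ≡⟨ m≡m%n+[m/n]*n (toℕ x) m ⟩
        block x + toℕ x / m * m    ≡⟨ cong₂ (λ r q → r + q * m) (same-block px px′) quotient≡ ⟩
        block x′ + toℕ x′ / m * m  ≡⟨ m≡m%n+[m/n]*n (toℕ x′) m ⟨
        toℕ x′                     ∎))
      where open ≡-Reasoning

    block-count : ∀ r → ∑[ x < n ] 𝟙 (block x ≟ℕ r) ≤ D
    block-count r = same-block-count (λ x → block x ≟ℕ r) (λ b≡r b′≡r → trans b≡r (sym b′≡r))

    stage-count : ∀ p t → ∑[ x < n ] 𝟙 (stage p x ≟ℕ t) ≤ D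
    stage-count p t = same-block-count (λ x → stage p x ≟ℕ t) λ {x} {x′} s≡t s′≡t →
      trans (sym (col+stage p x)) (trans (cong (λ s → (col p + s) % m) (trans s≡t (sym s′≡t))) (col+stage p x′))

    -- n < (m + 1)² = m (m + 2) + 1 gives n / m ≤ m + 2, so D ≤ 4 m and D² ≤ 16 m² ≤ 16 n.
    D*D≤16n : D * D ≤ 16 * n
    D*D≤16n = begin
        D * D              ≤⟨ *-mono-≤ D≤4m D≤4m ⟩
        4 * m * (4 * m)    ≡⟨ solve 1 (λ m → (con 4 :* m) :* (con 4 :* m) := con 16 :* (m :* m)) refl m ⟩
        16 * (m * m)       ≤⟨ *-monoʳ-≤ 16 m*m≤n ⟩
        16 * n             ∎
      where
      open ≤-Reasoning
      n≤[m+2]*m : n ≤ (m + 2) * m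
      n≤[m+2]*m = ≤-pred (≤-trans n<[m+1]²
        (≤-reflexive (solve 1 (λ m → (con 1 :+ m) :* (con 1 :+ m) := con 1 :+ (m :+ con 2) :* m) refl m)))
      D≤4m : D ≤ 4 * m
      D≤4m = begin
        suc (n / m)    ≤⟨ s≤s (≤-trans (/-monoˡ-≤ m n≤[m+2]*m) (≤-reflexive (m*n/n≡m (m + 2) m))) ⟩
        suc (m + 2)    ≡⟨ solve 1 (λ m → con 1 :+ (m :+ con 2) := con 3 :+ m) refl m ⟩
        3 + m          ≤⟨ +-monoˡ-≤ m (*-monoʳ-≤ 3 (>-nonZero⁻¹ m)) ⟩
        3 * m + m      ≡⟨ solve 1 (λ m → con 3 :* m :+ m := con 4 :* m) refl m ⟩
        4 * m          ∎

    owns-count : ∀ p → ∑₂ (λ i j → 𝟙 (owns? p i j)) ≤ D * D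
    owns-count p = ≤-trans (∑₂-𝟙≤* (owns? p) (λ i → block i ≟ℕ row p) (λ j → block j ≟ℕ (row p + col p) % m)
                                   (λ (_ , row≡ , diag≡) → row≡ , diag≡))
                           (*-mono-≤ (block-count _) (block-count _))

    needsA-count : ∀ t p → ∑₂ (λ i x → 𝟙 (needsA? t p i x)) ≤ D * D
    needsA-count t p = ≤-trans (∑₂-𝟙≤* (needsA? t p) (λ i → block i ≟ℕ row p) (λ x → stage p x ≟ℕ t)
                                       (λ (_ , row≡ , stage≡) → row≡ , stage≡))
                               (*-mono-≤ (block-count _) (stage-count p t))

    needsB-count : ∀ t p → ∑₂ (λ x j → 𝟙 (needsB? t p x j)) ≤ D * D
    needsB-count t p = ≤-trans (∑₂-𝟙≤* (needsB? t p) (λ x → stage p x ≟ℕ t) (λ j → block j ≟ℕ (row p + col p) % m)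
                                       (λ (_ , diag≡ , stage≡) → stage≡ , diag≡))
                               (*-mono-≤ (stage-count p t) (block-count _))

    owner-of : ∀ {w} → IsInput w → ∃ λ q → w ∈ s₀ q
    owner-of = proj₂ (proj₂ initial)

    ownerA : Fin n → Fin n → Fin n
    ownerA i x = proj₁ (owner-of (inA i x))

    ownerB : Fin n → Fin n → Fin n
    ownerB x j = proj₁ (owner-of (inB x j))

    accumulated : Fin n → ℕ → Subset n
    accumulated p t = subset (λ x → stage p x <? t)

    due : Fin n → ℕ → Subset n
    due p t = subset (λ x → stage p x ≟ℕ t)

    partials : ℕ → Fin n → List (Word n)
    partials zero    p = []
    partials (suc t) p = select (owns? p) (λ i j → part i j (accumulated p (suc t)))

    received : ℕ → Fin n → List (Word n)
    received t p = select (needsA? t p) entA ++ select (needsB? t p) entB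

    message : ℕ → Fin n → Fin n → List (Word n)
    message t q p = select (λ i x → needsA? t p i x ×-dec ownerA i x ≟ q) entA
                 ++ select (λ x j → needsB? t p x j ×-dec ownerB x j ≟ q) entB

    -- Inputs, partial sums over the indices of the stages before t, and the entries needed in stage t.
    memory : ℕ → Config n
    memory t p = s₀ p ++ (partials t p ++ received t p)

    M : ℕ
    M = 50 * n

    partials-length : ∀ t p → length (partials t p) ≤ D * D
    partials-length zero    p = z≤n
    partials-length (suc t) p = ≤-trans (≤-reflexive (length-select (owns? p) _)) (owns-count p)

    received-length : ∀ t p → length (received t p) ≤ D * D + D * D
    received-length t p = ≤-trans (≤-reflexive (trans (length-++ (select (needsA? t p) entA))
                                                       (cong₂ _+_ (length-select (needsA? t p) entA) (length-select (needsB? t p) entB))))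
                                  (+-mono-≤ (needsA-count t p) (needsB-count t p))

    s₀-length : ∀ p → length (s₀ p) ≡ 2 * n
    s₀-length = proj₁ (proj₂ initial)

    local-length : ∀ t p → length (s₀ p ++ partials t p) ≤ M
    local-length t p = begin
        length (s₀ p ++ partials t p)
      ≡⟨ length-++ (s₀ p) ⟩
        length (s₀ p) + length (partials t p)
      ≤⟨ +-mono-≤ (≤-reflexive (s₀-length p)) (≤-trans (partials-length t p) D*D≤16n) ⟩
        2 * n + 16 * n
      ≡⟨ solve 1 (λ n → con 2 :* n :+ con 16 :* n := con 18 :* n) refl n ⟩
        18 * n
      ≤⟨ *-monoˡ-≤ n (m≤m+n 18 32) ⟩
        M
      ∎
      where open ≤-Reasoning

    memory-length : ∀ t p → length (memory t p) ≤ M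
    memory-length t p = begin
        length (memory t p)
      ≡⟨ trans (length-++ (s₀ p)) (cong₂ _+_ (s₀-length p) (length-++ (partials t p))) ⟩
        2 * n + (length (partials t p) + length (received t p))
      ≤⟨ +-monoʳ-≤ (2 * n) (+-mono-≤ (partials-length t p) (received-length t p)) ⟩
        2 * n + (D * D + (D * D + D * D))
      ≤⟨ +-monoʳ-≤ (2 * n) (+-mono-≤ D*D≤16n (+-mono-≤ D*D≤16n D*D≤16n)) ⟩
        2 * n + (16 * n + (16 * n + 16 * n))
      ≡⟨ solve 1 (λ n → con 2 :* n :+ (con 16 :* n :+ (con 16 :* n :+ con 16 :* n)) := con 50 :* n) refl n ⟩
        M
      ∎
      where open ≤-Reasoning

    message-length : ∀ t q p → length (message t q p) ≡
      ∑₂ (λ i x → 𝟙 (needsA? t p i x) * 𝟙 (ownerA i x ≟ q)) + ∑₂ (λ x j → 𝟙 (needsB? t p x j) * 𝟙 (ownerB x j ≟ q))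
    message-length t q p = trans (length-++ (select (λ i x → needsA? t p i x ×-dec ownerA i x ≟ q) entA)) (cong₂ _+_
      (trans (length-select (λ i x → needsA? t p i x ×-dec ownerA i x ≟ q) entA)
             (sum-cong-≗ {n} λ i → sum-cong-≗ {n} λ x → 𝟙-× (needsA? t p i x) (ownerA i x ≟ q)))
      (trans (length-select (λ x j → needsB? t p x j ×-dec ownerB x j ≟ q) entB)
             (sum-cong-≗ {n} λ x → sum-cong-≗ {n} λ j → 𝟙-× (needsB? t p x j) (ownerB x j ≟ q))))

    -- Each entry a_ix is needed by at most one processor per stage and owned by exactly one,
    -- so a processor sends at most its 2n inputs and receives at most what it needs.
    sent-count : ∀ t q → ∑[ p < n ] length (message t q p) ≤ M
    sent-count t q = begin
        ∑[ p < n ] length (message t q p)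
      ≡⟨ trans (sum-cong-≗ (message-length t q)) (∑-distrib-+ (λ p → ∑₂ (λ i x → 𝟙 (needsA? t p i x) * 𝟙 (ownerA i x ≟ q))) _) ⟩
        ∑[ p < n ] ∑₂ (λ i x → 𝟙 (needsA? t p i x) * 𝟙 (ownerA i x ≟ q))
          + ∑[ p < n ] ∑₂ (λ x j → 𝟙 (needsB? t p x j) * 𝟙 (ownerB x j ≟ q))
      ≤⟨ +-mono-≤ (∑-∑₂-𝟙*≤ (λ p → needsA? t p) needsA-unique _) (∑-∑₂-𝟙*≤ (λ p → needsB? t p) needsB-unique _) ⟩
        ∑₂ (λ i x → 𝟙 (ownerA i x ≟ q)) + ∑₂ (λ x j → 𝟙 (ownerB x j ≟ q))
      ≤⟨ +-mono-≤ (sum-mono-≤ λ i → sum-mono-≤ λ x → 𝟙-mono (ownerA i x ≟ q) (entA i x ∈ʷ? s₀ q) (λ { refl → proj₂ (owner-of (inA i x)) }))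
                  (sum-mono-≤ λ x → sum-mono-≤ λ j → 𝟙-mono (ownerB x j ≟ q) (entB x j ∈ʷ? s₀ q) (λ { refl → proj₂ (owner-of (inB x j)) })) ⟩
        ∑₂ (λ i x → 𝟙 (entA i x ∈ʷ? s₀ q)) + ∑₂ (λ x j → 𝟙 (entB x j ∈ʷ? s₀ q))
      ≤⟨ +-mono-≤ (entA-count≤length (s₀ q)) (entB-count≤length (s₀ q)) ⟩
        length (s₀ q) + length (s₀ q)
      ≡⟨ cong₂ _+_ (s₀-length q) (s₀-length q) ⟩
        2 * n + 2 * n
      ≡⟨ solve 1 (λ n → con 2 :* n :+ con 2 :* n := con 4 :* n) refl n ⟩
        4 * n
      ≤⟨ *-monoˡ-≤ n (m≤m+n 4 46) ⟩
        M
      ∎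
      where open ≤-Reasoning

    received-count : ∀ t p → ∑[ q < n ] length (message t q p) ≤ M
    received-count t p = begin
        ∑[ q < n ] length (message t q p)
      ≡⟨ trans (sum-cong-≗ (λ q → trans (message-length t q p)
                   (cong₂ _+_ (∑₂-*-comm (λ i x → 𝟙 (needsA? t p i x)) (λ i x → 𝟙 (ownerA i x ≟ q)))
                              (∑₂-*-comm (λ x j → 𝟙 (needsB? t p x j)) (λ x j → 𝟙 (ownerB x j ≟ q))))))
               (∑-distrib-+ (λ q → ∑₂ (λ i x → 𝟙 (ownerA i x ≟ q) * 𝟙 (needsA? t p i x))) _) ⟩
        ∑[ q < n ] ∑₂ (λ i x → 𝟙 (ownerA i x ≟ q) * 𝟙 (needsA? t p i x))
          + ∑[ q < n ] ∑₂ (λ x j → 𝟙 (ownerB x j ≟ q) * 𝟙 (needsB? t p x j))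
      ≤⟨ +-mono-≤ (∑-∑₂-𝟙*≤ (λ q i x → ownerA i x ≟ q) (λ q≡ q′≡ → trans (sym q≡) q′≡) _)
                  (∑-∑₂-𝟙*≤ (λ q x j → ownerB x j ≟ q) (λ q≡ q′≡ → trans (sym q≡) q′≡) _) ⟩
        ∑₂ (λ i x → 𝟙 (needsA? t p i x)) + ∑₂ (λ x j → 𝟙 (needsB? t p x j))
      ≤⟨ +-mono-≤ (needsA-count t p) (needsB-count t p) ⟩
        D * D + D * D
      ≤⟨ +-mono-≤ D*D≤16n D*D≤16n ⟩
        16 * n + 16 * n
      ≡⟨ solve 1 (λ n → con 16 :* n :+ con 16 :* n := con 32 :* n) refl n ⟩
        32 * n
      ≤⟨ *-monoˡ-≤ n (m≤m+n 32 18) ⟩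
        M
      ∎
      where
      open ≤-Reasoning
      ∑₂-*-comm : (f g : Fin n → Fin n → ℕ) → ∑₂ (λ i j → f i j * g i j) ≡ ∑₂ (λ i j → g i j * f i j)
      ∑₂-*-comm f g = sum-cong-≗ λ i → sum-cong-≗ λ j → *-comm (f i j) (g i j)

    message⊆inputs : ∀ t q p {w} → w ∈ message t q p → w ∈ s₀ q
    message⊆inputs t q p w∈ with ∈-++⁻ (select (λ i x → needsA? t p i x ×-dec ownerA i x ≟ q) entA) w∈
    ... | inj₁ w∈A = let i , x , (_ , owner≡q) , w≡ = ∈-select⁻ (λ i x → needsA? t p i x ×-dec ownerA i x ≟ q) entA w∈A
                     in subst₂ (λ w q → w ∈ s₀ q) (sym w≡) owner≡q (proj₂ (owner-of (inA i x)))
    ... | inj₂ w∈B = let x , j , (_ , owner≡q) , w≡ = ∈-select⁻ (λ x j → needsB? t p x j ×-dec ownerB x j ≟ q) entB w∈B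
                     in subst₂ (λ w q → w ∈ s₀ q) (sym w≡) owner≡q (proj₂ (owner-of (inB x j)))

    received⇒message : ∀ t p {w} → w ∈ received t p → ∃ λ q → w ∈ message t q p
    received⇒message t p w∈ with ∈-++⁻ (select (needsA? t p) entA) w∈
    ... | inj₁ w∈A with ∈-select⁻ (needsA? t p) entA w∈A
    ...   | i , x , needs , refl = ownerA i x , ∈-++⁺ˡ (∈-select⁺ (λ i′ x′ → needsA? t p i′ x′ ×-dec ownerA i′ x′ ≟ ownerA i x) entA (needs , refl))
    received⇒message t p w∈ | inj₂ w∈B with ∈-select⁻ (needsB? t p) entB w∈B
    ...   | x , j , needs , refl = ownerB x j , ∈-++⁺ʳ _ (∈-select⁺ (λ x′ j′ → needsB? t p x′ j′ ×-dec ownerB x′ j′ ≟ ownerB x j) entB (needs , refl))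

    exchange-round : ∀ {s} t → (∀ p {w} → w ∈ s₀ p ++ partials t p → Derivable (s p) w) → Round M s (memory t)
    exchange-round t derive = record
      { L      = λ p → s₀ p ++ partials t p
      ; msg    = message t
      ; local  = derive
      ; locMem = local-length t
      ; sendOk = λ q p w∈ → ∈-++⁺ˡ (message⊆inputs t q p w∈)
      ; sent   = λ q → ≤-trans (≤-reflexive (sum-map-allFin (λ p → length (message t q p)))) (sent-count t q)
      ; recv   = λ p → ≤-trans (≤-reflexive (sum-map-allFin (λ q → length (message t q p)))) (received-count t p)
      ; newOk  = kept-or-received
      ; newMem = memory-length t
      }
      where
      kept-or-received : ∀ p {w} → w ∈ memory t p → w ∈ s₀ p ++ partials t p ⊎ ∃ λ q → w ∈ message t q p
      kept-or-received p w∈ with ∈-++⁻ (s₀ p) w∈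
      ... | inj₁ w∈s₀ = inj₁ (∈-++⁺ˡ w∈s₀)
      ... | inj₂ w∈rest with ∈-++⁻ (partials t p) w∈rest
      ...   | inj₁ w∈partials = inj₁ (∈-++⁺ʳ (s₀ p) w∈partials)
      ...   | inj₂ w∈received = inj₂ (received⇒message t p w∈received)

    accumulated-zero : ∀ p → accumulated p 0 ≡ ⊥
    accumulated-zero p = Empty-unique λ (x , x∈) → n≮0 (∈-subset⁻ (λ x → stage p x <? 0) x∈)

    accumulated-suc : ∀ p t → accumulated p (suc t) ≡ accumulated p t ∪ due p t
    accumulated-suc p t = ⊆-antisym ⊆∪ ∪⊆
      where
      ⊆∪ : accumulated p (suc t) ⊆ accumulated p t ∪ due p t
      ⊆∪ {x} x∈ with m<1+n⇒m<n∨m≡n (∈-subset⁻ (λ x → stage p x <? suc t) x∈)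
      ... | inj₁ stage<t = x∈p∪q⁺ (inj₁ (∈-subset⁺ (λ x → stage p x <? t) stage<t))
      ... | inj₂ stage≡t = x∈p∪q⁺ (inj₂ (∈-subset⁺ (λ x → stage p x ≟ℕ t) stage≡t))
      ∪⊆ : accumulated p t ∪ due p t ⊆ accumulated p (suc t)
      ∪⊆ {x} x∈ with x∈p∪q⁻ (accumulated p t) (due p t) x∈
      ... | inj₁ x∈acc = ∈-subset⁺ (λ x → stage p x <? suc t) (m<n⇒m<1+n (∈-subset⁻ (λ x → stage p x <? t) x∈acc))
      ... | inj₂ x∈due = ∈-subset⁺ (λ x → stage p x <? suc t) (s≤s (≤-reflexive (∈-subset⁻ (λ x → stage p x ≟ℕ t) x∈due)))

    accumulated-all : ∀ p → accumulated p m ≡ ⊤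
    accumulated-all p = ⊆-antisym (λ _ → ∈⊤) (λ {x} _ → ∈-subset⁺ (λ x → stage p x <? m) (stage<m p x))

    accumulated-disjoint : ∀ p t → Empty (accumulated p t ∩ due p t)
    accumulated-disjoint p t (x , x∈) = let x∈acc , x∈due = x∈p∩q⁻ (accumulated p t) (due p t) x∈ in
      <-irrefl (∈-subset⁻ (λ x → stage p x ≟ℕ t) x∈due) (∈-subset⁻ (λ x → stage p x <? t) x∈acc)

    due-nonempty : ∀ p {t} → t < m → Nonempty (due p t)
    due-nonempty p {t} t<m = x₀ , ∈-subset⁺ (λ x → stage p x ≟ℕ t) (stage-≡ t<m (sym block-x₀))
      where
      r<n : (col p + t) % m < n
      r<n = <-≤-trans (m%n<n _ m) (≤-trans (m≤m*n m m) m*m≤n)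
      x₀ = fromℕ< r<n
      block-x₀ : block x₀ ≡ (col p + t) % m
      block-x₀ = trans (cong (_% m) (toℕ-fromℕ< r<n)) (m%n%n≡m%n _ m)

    due-factors : ∀ {t p i j x} → Owns p i j → x ∈ₛ due p t → entA i x ∈ memory t p × entB x j ∈ memory t p
    due-factors {t} {p} {i} {j} {x} (grid , row≡ , diag≡) x∈due =
        ∈-++⁺ʳ (s₀ p) (∈-++⁺ʳ (partials t p) (∈-++⁺ˡ (∈-select⁺ (needsA? t p) entA (grid , row≡ , stage≡))))
      , ∈-++⁺ʳ (s₀ p) (∈-++⁺ʳ (partials t p) (∈-++⁺ʳ (select (needsA? t p) entA) (∈-select⁺ (needsB? t p) entB (grid , diag≡ , stage≡))))
      where stage≡ = ∈-subset⁻ (λ x → stage p x ≟ℕ t) x∈due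

    derive-due : ∀ {t p i j} → t < m → Owns p i j → Derivable (memory t p) (part i j (due p t))
    derive-due {p = p} t<m owns = derivable-part (due p _) (due-nonempty p t<m) (due-factors owns)

    derive-accumulated : ∀ t {p i j} → t < m → Owns p i j → Derivable (memory t p) (part i j (accumulated p (suc t)))
    derive-accumulated zero {p} t<m owns
      rewrite accumulated-suc p 0 | accumulated-zero p | ∪-identityˡ (due p 0) = derive-due t<m owns
    derive-accumulated (suc t) {p} {i} {j} t<m owns rewrite accumulated-suc p (suc t) =
      add (hold (∈-++⁺ʳ (s₀ p) (∈-++⁺ˡ (∈-select⁺ (owns? p) (λ i j → part i j (accumulated p (suc t))) owns))))
          (derive-due t<m owns) (accumulated-disjoint p (suc t))

    round-zero : Round M s₀ (memory 0)
    round-zero = exchange-round 0 (λ p w∈ → hold (subst (_ ∈_) (++-identityʳ (s₀ p)) w∈))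

    round-suc : ∀ t → t < m → Round M (memory t) (memory (suc t))
    round-suc t t<m = exchange-round (suc t) derive
      where
      derive : ∀ p {w} → w ∈ s₀ p ++ partials (suc t) p → Derivable (memory t p) w
      derive p w∈ with ∈-++⁻ (s₀ p) w∈
      ... | inj₁ w∈s₀ = hold (∈-++⁺ˡ w∈s₀)
      ... | inj₂ w∈partials with ∈-select⁻ (owns? p) (λ i j → part i j (accumulated p (suc t))) w∈partials
      ...   | i , j , owns , refl = derive-accumulated t t<m owns

    -- The owner of c_ij sits at row block i and column (block j − block i) mod m.
    owner : ∀ i j → ∃ λ p → Owns p i j
    owner i j = p , p<m*m , sym row≡ , trans diag≡ (cong₂ (λ r c → (r + c) % m) (sym row≡) (sym col≡))
      where
      I = block i
      K = (block j + (m ∸ I)) % m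
      v<m*m : K + I * m < m * m
      v<m*m = <-≤-trans (+-monoˡ-< (I * m) (m%n<n _ m)) (*-monoˡ-≤ m (block<m i))
      p = fromℕ< (<-≤-trans v<m*m m*m≤n)
      p≡ : toℕ p ≡ K + I * m
      p≡ = toℕ-fromℕ< (<-≤-trans v<m*m m*m≤n)
      p<m*m : OnGrid p
      p<m*m = subst (_< m * m) (sym p≡) v<m*m
      col≡ : col p ≡ K
      col≡ = trans (cong (_% m) p≡) (trans ([m+kn]%n≡m%n K I m) (m%n%n≡m%n _ m))
      row≡ : row p ≡ I
      row≡ = *-cancelʳ-≡ (row p) I m (+-cancelˡ-≡ K _ _ (trans (cong (_+ row p * m) (sym col≡)) (trans (sym (position p)) p≡)))
      diag≡ : block j ≡ (I + K) % m
      diag≡ = sym (trans (∸-+-inverse m (block j) (block<m i)) (m%n%n≡m%n (toℕ j) m))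

    output : Output (memory m)
    output i j = let p , owns = owner i j in
      p , subst (λ t → part i j ⊤ ∈ memory t p) (suc-pred m)
                (∈-++⁺ʳ (s₀ p) (∈-++⁺ˡ (subst (λ S → part i j S ∈ partials (suc (pred m)) p)
                                               (trans (cong (accumulated p) (suc-pred m)) (accumulated-all p))
                                               (∈-select⁺ (owns? p) (λ i j → part i j (accumulated p (suc (pred m)))) owns))))

    run-from : ∀ k t → t + k ≡ m → Run M (memory t) k
    run-from zero    t t+0≡m = subst (λ t → Run M (memory t) 0) (sym (trans (sym (+-identityʳ t)) t+0≡m)) (done output)
    run-from (suc k) t t+k≡m = step (round-suc t (subst (t <_) t+k≡m (m<m+n t (s≤s z≤n))))
                                    (run-from k (suc t) (trans (sym (+-suc t k)) t+k≡m))

    run : Run M s₀ (suc m)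
    run = step round-zero (run-from m 0 refl)

  isqrt : ∀ n → ∃ λ m → m * m ≤ n × n < suc m * suc m
  isqrt zero = 0 , z≤n , s≤s z≤n
  isqrt (suc n) with isqrt n
  ... | m , m*m≤n , n<[m+1]² with suc m * suc m ≤? suc n
  ...   | yes [m+1]²≤1+n = suc m , [m+1]²≤1+n , ≤-trans (s≤s n<[m+1]²) (≤-trans (s≤s (m≤m+n (suc m * suc m) (2 + 2 * m)))
           (≤-reflexive (solve 1 (λ m → con 1 :+ ((con 1 :+ m) :* (con 1 :+ m) :+ (con 2 :+ con 2 :* m)) := (con 2 :+ m) :* (con 2 :+ m)) refl m)))
  ...   | no  [m+1]²≰1+n = m , ≤-trans m*m≤n (n≤1+n n) , ≰⇒> [m+1]²≰1+n

  upper-bound : ∃₂ λ c K → ∀ n (s₀ : Config n) → InitialDist n s₀ → ∃ λ R → Run (c * n) s₀ R × R * R ≤ K * n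
  upper-bound = 50 , 4 , bound
    where
    bound : ∀ n (s₀ : Config n) → InitialDist n s₀ → ∃ λ R → Run (50 * n) s₀ R × R * R ≤ 4 * n
    bound zero s₀ _ = 0 , done (λ ()) , z≤n
    bound n@(suc _) s₀ initial with isqrt n
    ... | zero   , _     , s≤s ()
    ... | suc m₁ , m*m≤n , n<[m+1]² = 2 + m₁ , Cannon.run n (suc m₁) m*m≤n n<[m+1]² s₀ initial , R*R≤4n
      where
      R*R≤4n : (2 + m₁) * (2 + m₁) ≤ 4 * n
      R*R≤4n = ≤-trans (≤-trans (m≤m+n _ (3 * (m₁ * m₁) + 4 * m₁))
                                (≤-reflexive (solve 1 (λ k → (con 2 :+ k) :* (con 2 :+ k) :+ (con 3 :* (k :* k) :+ con 4 :* k)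
                                                           := con 4 :* ((con 1 :+ k) :* (con 1 :+ k))) refl m₁)))
                       (*-monoʳ-≤ 4 m*m≤n)

open LowerBound using (lower-bound)
open UpperBound using (upper-bound)

theorem4 :
    (∃₂ λ c K → ∀ n (s₀ : Config n) → InitialDist n s₀ →
       ∃ λ R → Run (c * n) s₀ R × R * R ≤ K * n)
    ×
    (∀ c → ∃ λ k → ∀ n (s₀ : Config n) → InitialDist n s₀ →
       ∀ R → Run (c * n) s₀ R → n ≤ k * (R * R))
theorem4 = upper-bound , lower-bound
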